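{- Let $q$ be an odd prime power and $V_{\mathrm s}$ the space of symmetric $3\times3$ matrices over $\mathbb{F}_q$. If $\ell$ is a line of $\mathrm{PG}(V_{\mathrm s})$ all of whose points have rank $2$, and $\ell$ is not contained in a conic plane, then every point of $\ell$ is an exterior point.
   Context: Let $\nu_3:\mathrm{PG}(2,\mathbb{F}_q)\to\mathrm{PG}(V_{\mathrm s})$, $\langle u\rangle\mapsto\langle uu^\top\rangle$, be the Veronese map. For a line $m$ of $\mathrm{PG}(2,\mathbb{F}_q)$, $\nu_3(m)$ is a conic, and its span $\langle\nu_3(m)\rangle$ is called a conic plane. Each rank-$2$ point $R$ lies in a unique conic plane; $\mathcal{C}(R)$ denotes the conic of $\mathcal{V}_3(\mathbb{F}_q)=\nu_3(\mathrm{PG}(2,\mathbb{F}_q))$ in that plane. $R$ is an exterior point if it lies on a tangent line to $\mathcal{C}(R)$, and an interior point otherwise. -}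

module Defs where

open import Level using (Level; _⊔_)
open import Data.Nat using (ℕ)
open import Data.Nat.Primality using (Prime)
open import Data.Nat.Divisibility using (_∣_)
open import Data.Fin using (Fin)
open import Data.Product using (Σ; ∃; _×_; _,_)
open import Data.List using (List; []; _∷_)
open import Data.List.Relation.Unary.All using (All)
open import Relation.Nullary using (¬_)
open import Relation.Binary.PropositionalEquality using (_≡_)
open import Algebra.Bundles using (CommutativeRing)

OddPrimePower : ℕ → Set
OddPrimePower q = (Σ ℕ λ p → Σ ℕ λ k → Prime p × q ≡ p Data.Nat.^ Data.Nat.suc k) × ¬ (2 ∣ q)

module Geometry {c ℓ : Level} (F : CommutativeRing c ℓ) where
  open CommutativeRing F renaming (Carrier to K)

  IsField : Set (c ⊔ ℓ)
  IsField = (1# ≉ 0#) × (∀ x → x ≉ 0# → Σ K λ y → x * y ≈ 1#)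

  HasSize : ℕ → Set (c ⊔ ℓ)
  HasSize q = Σ (Fin q → K) λ e →
                (∀ i j → e i ≈ e j → i ≡ j) × (∀ x → Σ (Fin q) λ i → x ≈ e i)

  IsFiniteFieldOfOrder : ℕ → Set (c ⊔ ℓ)
  IsFiniteFieldOfOrder q = IsField × HasSize q

  -- Vectors of F^3 (points of PG(2,F_q) are nonzero vectors up to scalars)
  record V3 : Set c where
    constructor vec
    field x₁ x₂ x₃ : K

  NonzeroV : V3 → Set ℓ
  NonzeroV (vec a b d) = ¬ ((a ≈ 0#) × (b ≈ 0#) × (d ≈ 0#))

  -- the line m = { u : w · u = 0 } of PG(2,F_q) given by a nonzero w
  dot : V3 → V3 → K
  dot (vec a b d) (vec a' b' d') = a * a' + b * b' + d * d'

  OnLine : V3 → V3 → Set ℓ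
  OnLine w u = dot w u ≈ 0#

  -- Symmetric 3x3 matrices  [[a11 a12 a13] [a12 a22 a23] [a13 a23 a33]]
  record Sym : Set c where
    constructor smat
    field a11 a12 a13 a22 a23 a33 : K

  _≈S_ : Sym → Sym → Set ℓ
  smat a b d e f g ≈S smat a' b' d' e' f' g' =
    (a ≈ a') × (b ≈ b') × (d ≈ d') × (e ≈ e') × (f ≈ f') × (g ≈ g')

  zeroS : Sym
  zeroS = smat 0# 0# 0# 0# 0# 0#

  NonzeroS : Sym → Set ℓ
  NonzeroS A = ¬ (A ≈S zeroS)

  _+S_ : Sym → Sym → Sym
  smat a b d e f g +S smat a' b' d' e' f' g' =
    smat (a + a') (b + b') (d + d') (e + e') (f + f') (g + g')

  _·S_ : K → Sym → Sym
  k ·S smat a b d e f g = smat (k * a) (k * b) (k * d) (k * e) (k * f) (k * g)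

  comb : K → Sym → K → Sym → Sym
  comb λ' A μ B = (λ' ·S A) +S (μ ·S B)

  outer : V3 → Sym
  outer (vec a b d) = smat (a * a) (a * b) (a * d) (b * b) (b * d) (d * d)

  -- Rank via minors: rank A = 2  iff  det A = 0 and some 2x2 minor is nonzero.
  det : Sym → K
  det (smat a b d e f g) =
    a * (e * g - f * f) - b * (b * g - f * d) + d * (b * f - e * d)

  AllMinorsZero : Sym → Set ℓ
  AllMinorsZero (smat a b d e f g) =
    (a * e - b * b ≈ 0#) × (a * f - d * b ≈ 0#) × (b * f - d * e ≈ 0#) ×
    (a * f - b * d ≈ 0#) × (a * g - d * d ≈ 0#) × (b * g - d * f ≈ 0#) ×
    (b * f - e * d ≈ 0#) × (b * g - f * d ≈ 0#) × (e * g - f * f ≈ 0#)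

  Rank2 : Sym → Set ℓ
  Rank2 A = (det A ≈ 0#) × ¬ (AllMinorsZero A)

  NonzeroPair : K → K → Set ℓ
  NonzeroPair λ' μ = ¬ ((λ' ≈ 0#) × (μ ≈ 0#))

  Independent : Sym → Sym → Set (c ⊔ ℓ)
  Independent A B = ∀ λ' μ → comb λ' A μ B ≈S zeroS → (λ' ≈ 0#) × (μ ≈ 0#)

  SamePoint : Sym → Sym → Set (c ⊔ ℓ)
  SamePoint A B = Σ K λ k → (k ≉ 0#) × (A ≈S (k ·S B))

  OnLineThrough : Sym → Sym → Sym → Set (c ⊔ ℓ)
  OnLineThrough P₁ P₂ R = Σ K λ λ' → Σ K λ μ → R ≈S comb λ' P₁ μ P₂

  -- conic planes: ⟨ν₃(m)⟩ = span { u uᵀ : w · u = 0 }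
  sumOuter : List (K × V3) → Sym
  sumOuter [] = zeroS
  sumOuter ((k , u) ∷ ts) = (k ·S outer u) +S sumOuter ts

  InConicPlane : V3 → Sym → Set (c ⊔ ℓ)
  InConicPlane w R = Σ (List (K × V3)) λ ts →
    All (λ t → OnLine w (Data.Product.proj₂ t)) ts × (R ≈S sumOuter ts)

  -- the line ⟨P₁,P₂⟩ lies in the plane ⟨ν₃(m)⟩ and meets the conic ν₃(m)
  -- in exactly one point: it is a tangent line to the conic ν₃(m)
  TangentLine : V3 → Sym → Sym → Set (c ⊔ ℓ)
  TangentLine w P₁ P₂ =
    Independent P₁ P₂ × InConicPlane w P₁ × InConicPlane w P₂ ×
    (Σ V3 λ u₀ → NonzeroV u₀ × OnLine w u₀ × OnLineThrough P₁ P₂ (outer u₀) ×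
       (∀ u → NonzeroV u → OnLine w u → OnLineThrough P₁ P₂ (outer u) →
          SamePoint (outer u) (outer u₀)))

  -- R (of rank 2) is an exterior point: R lies in a conic plane, and for the
  -- conic plane ⟨ν₃(m)⟩ containing R (unique), R lies on a tangent line
  -- to the conic C(R) = ν₃(m).
  Exterior : Sym → Set (c ⊔ ℓ)
  Exterior R =
    (Σ V3 λ w → NonzeroV w × InConicPlane w R) ×
    (∀ w → NonzeroV w → InConicPlane w R →
       Σ Sym λ P₁ → Σ Sym λ P₂ → TangentLine w P₁ P₂ × OnLineThrough P₁ P₂ R)

-- Write the line as the pencil λ A + μ B, fix a point R on it and pick a second point S.
-- Every point is singular, so det (S + t R) = t (c₁ + c₂ t) with c₁ = tr (adj S · R);
-- it vanishes at t = 1 and at some t₀ ∉ {0, 1} (here q ≥ 3 is used), hence c₁ = 0.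
-- As S has rank 2, adj S is a multiple of x xᵀ for a kernel vector x of S, so xᵀ R x = 0.
-- The symmetric matrices annihilating w ≠ 0 form exactly the conic plane of w; therefore
-- u = R x ≠ 0, since otherwise the whole line would lie in the conic plane of x. If R lies
-- in the conic plane of w, then w · u = xᵀ R w = 0, and the line ⟨R, u uᵀ⟩ is tangent:
-- from v vᵀ = α R + β u uᵀ we get (v · x)² = α xᵀ R x = 0, so α u = (v · x) v = 0 and α = 0.

module Submission where

open import Level using (Level; 0ℓ; _⊔_)
open import Algebra.Bundles using (CommutativeRing; RawRing)
open import Algebra.Morphism.Structures using (IsRingMonomorphism)
import Algebra.Morphism.RingMonomorphism as RingMonomorphism
import Algebra.Construct.Pointwise as Pointwise
open import Data.Empty using (⊥-elim)
open import Data.Fin using (Fin; zero; suc)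
import Data.Fin.Properties as Fin
open import Data.Integer as ℤ using (ℤ; +_; -[1+_]; _⊖_)
import Data.Integer.Properties as ℤ
open import Data.List using (List; []; _∷_)
open import Data.List.Relation.Unary.All using (All; []; _∷_)
open import Data.Maybe using (Maybe; just; nothing)
open import Data.Nat as ℕ using (ℕ; zero; suc)
import Data.Nat.Properties as ℕ
open import Data.Nat.Divisibility using (_∣0; ∣-refl)
open import Data.Nat.Primality using (Prime; ¬prime[1])
open import Data.Product using (Σ; _×_; _,_; proj₁; proj₂)
open import Data.Sign as Sign using (Sign)
open import Data.Sum using (_⊎_; inj₁; inj₂; [_,_])
open import Data.Vec using (Vec)
open import Data.Vec.N-ary using (N-ary; curryⁿ; Eq; Eqʰ; Eqʰ-to-Eq; curryⁿ-cong; curryⁿ-cong⁻¹)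
open import Relation.Binary using (Decidable)
open import Relation.Binary.PropositionalEquality as ≡ using (_≡_; _≢_)
open import Relation.Nullary using (¬_; yes; no)
open import Relation.Nullary.Decidable using (map′)
open import Algebra.Solver.Ring.AlmostCommutativeRing using (fromCommutativeRing; _-Raw-AlmostCommutative⟶_)
import Algebra.Solver.Ring
open import Defs

module IntegerCoefficients {c ℓ} (F : CommutativeRing c ℓ) where
  open CommutativeRing F hiding (zero) renaming (Carrier to K)
  open import Algebra.Properties.Ring ring using (-‿distribˡ-*; -‿distribʳ-*; -‿involutive; -0#≈0#; -‿+-comm)
  open import Algebra.Properties.Semiring.Mult.TCOptimised semiring using (1+×; ×-homo-+; ×1-homo-*)
    renaming (_×_ to _·_)
  open import Relation.Binary.Reasoning.Setoid setoid

  signed : Sign → K → K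
  signed Sign.+ x = x
  signed Sign.- x = - x

  ⟦_⟧ℤ : ℤ → K
  ⟦ i ⟧ℤ = signed (ℤ.sign i) (ℤ.∣ i ∣ · 1#)

  signed-cong : ∀ s {x y} → x ≈ y → signed s x ≈ signed s y
  signed-cong Sign.+ x≈y = x≈y
  signed-cong Sign.- x≈y = -‿cong x≈y

  signed-* : ∀ s t x y → signed (s Sign.* t) (x * y) ≈ signed s x * signed t y
  signed-* Sign.+ Sign.+ x y = refl
  signed-* Sign.+ Sign.- x y = -‿distribʳ-* x y
  signed-* Sign.- Sign.+ x y = -‿distribˡ-* x y
  signed-* Sign.- Sign.- x y = begin
    x * y        ≈⟨ -‿involutive (x * y) ⟨
    - - (x * y)  ≈⟨ -‿cong (-‿distribʳ-* x y) ⟩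
    - (x * - y)  ≈⟨ -‿distribˡ-* x (- y) ⟩
    - x * - y    ∎

  ⟦◃⟧ℤ : ∀ s n → ⟦ s ℤ.◃ n ⟧ℤ ≈ signed s (n · 1#)
  ⟦◃⟧ℤ Sign.+ zero    = refl
  ⟦◃⟧ℤ Sign.- zero    = sym -0#≈0#
  ⟦◃⟧ℤ Sign.+ (suc n) = refl
  ⟦◃⟧ℤ Sign.- (suc n) = refl

  *-homo : ∀ i j → ⟦ i ℤ.* j ⟧ℤ ≈ ⟦ i ⟧ℤ * ⟦ j ⟧ℤ
  *-homo i j = begin
    ⟦ s ℤ.◃ ℤ.∣ i ∣ ℕ.* ℤ.∣ j ∣ ⟧ℤ              ≈⟨ ⟦◃⟧ℤ s (ℤ.∣ i ∣ ℕ.* ℤ.∣ j ∣) ⟩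
    signed s ((ℤ.∣ i ∣ ℕ.* ℤ.∣ j ∣) · 1#)       ≈⟨ signed-cong s (×1-homo-* ℤ.∣ i ∣ ℤ.∣ j ∣) ⟩
    signed s ((ℤ.∣ i ∣ · 1#) * (ℤ.∣ j ∣ · 1#))  ≈⟨ signed-* (ℤ.sign i) (ℤ.sign j) _ _ ⟩
    ⟦ i ⟧ℤ * ⟦ j ⟧ℤ                             ∎
    where s = ℤ.sign i Sign.* ℤ.sign j

  -‿homo : ∀ i → ⟦ ℤ.- i ⟧ℤ ≈ - ⟦ i ⟧ℤ
  -‿homo -[1+ n ]  = sym (-‿involutive _)
  -‿homo (+ zero)  = sym -0#≈0#
  -‿homo (+ suc n) = refl

  ⊖-homo : ∀ m n → ⟦ m ⊖ n ⟧ℤ ≈ m · 1# - n · 1#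
  ⊖-homo zero    zero    = sym (trans (+-congˡ -0#≈0#) (+-identityʳ 0#))
  ⊖-homo zero    (suc n) = sym (+-identityˡ _)
  ⊖-homo (suc m) zero    = sym (trans (+-congˡ -0#≈0#) (+-identityʳ _))
  ⊖-homo (suc m) (suc n) = begin
    ⟦ suc m ⊖ suc n ⟧ℤ            ≡⟨ ≡.cong ⟦_⟧ℤ (ℤ.[1+m]⊖[1+n]≡m⊖n m n) ⟩
    ⟦ m ⊖ n ⟧ℤ                    ≈⟨ ⊖-homo m n ⟩
    m̂ - n̂                         ≈⟨ +-identityˡ _ ⟨
    0# + (m̂ - n̂)                  ≈⟨ +-congʳ (-‿inverseʳ 1#) ⟨
    (1# - 1#) + (m̂ - n̂)           ≈⟨ +-assoc 1# (- 1#) _ ⟩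
    1# + (- 1# + (m̂ - n̂))         ≈⟨ +-congˡ (+-assoc (- 1#) m̂ (- n̂)) ⟨
    1# + ((- 1# + m̂) - n̂)         ≈⟨ +-congˡ (+-congʳ (+-comm (- 1#) m̂)) ⟩
    1# + ((m̂ - 1#) - n̂)           ≈⟨ +-congˡ (+-assoc m̂ (- 1#) (- n̂)) ⟩
    1# + (m̂ + (- 1# - n̂))         ≈⟨ +-assoc 1# m̂ _ ⟨
    (1# + m̂) + (- 1# - n̂)         ≈⟨ +-congˡ (-‿+-comm 1# n̂) ⟩
    (1# + m̂) - (1# + n̂)           ≈⟨ +-cong (1+× m 1#) (-‿cong (1+× n 1#)) ⟨
    suc m · 1# - suc n · 1#       ∎
    where m̂ = m · 1#; n̂ = n · 1#

  +-homo : ∀ i j → ⟦ i ℤ.+ j ⟧ℤ ≈ ⟦ i ⟧ℤ + ⟦ j ⟧ℤ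
  +-homo -[1+ m ] -[1+ n ] = begin
    - (suc (suc (m ℕ.+ n)) · 1#)      ≡⟨ ≡.cong (λ k → - (suc k · 1#)) (ℕ.+-suc m n) ⟨
    - ((suc m ℕ.+ suc n) · 1#)        ≈⟨ -‿cong (×-homo-+ 1# (suc m) (suc n)) ⟩
    - (suc m · 1# + suc n · 1#)       ≈⟨ -‿+-comm _ _ ⟨
    - (suc m · 1#) + - (suc n · 1#)   ∎
  +-homo -[1+ m ] (+ n)    = trans (⊖-homo n (suc m)) (+-comm _ _)
  +-homo (+ m)    -[1+ n ] = ⊖-homo m (suc n)
  +-homo (+ m)    (+ n)    = ×-homo-+ 1# m n

  morphism : ℤ.+-*-rawRing -Raw-AlmostCommutative⟶ fromCommutativeRing F
  morphism = record
    { ⟦_⟧ = ⟦_⟧ℤ ; +-homo = +-homo ; *-homo = *-homo ; -‿homo = -‿homo ; 0-homo = refl ; 1-homo = refl }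

  _≟ℤ_ : ∀ i j → Maybe (⟦ i ⟧ℤ ≈ ⟦ j ⟧ℤ)
  i ≟ℤ j with i ℤ.≟ j
  ... | yes i≡j = just (reflexive (≡.cong ⟦_⟧ℤ i≡j))
  ... | no  _   = nothing

  module Solver = Algebra.Solver.Ring ℤ.+-*-rawRing (fromCommutativeRing F) morphism _≟ℤ_
  open Solver public using (Polynomial; con; _:+_; _:*_; :-_; _:-_; ⟦_⟧; ⟦_⟧↓; solve; _:=_; prove)
  open import Relation.Binary.Reflection setoid Solver.var ⟦_⟧ ⟦_⟧↓ Solver.correct public using (close)

  -- Expressions identified up to evaluation form a commutative ring. Instantiating the
  -- geometry over it lets solver goals be written with the very definitions they are about.
  Polynomials : ℕ → CommutativeRing 0ℓ (c ⊔ ℓ)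
  Polynomials n = record
    { isCommutativeRing = RingMonomorphism.isCommutativeRing ⟦⟧-isRingMonomorphism
                            (CommutativeRing.isCommutativeRing Functions) }
    where
    Functions = Pointwise.commutativeRing (Vec K n) F
    expressions : RawRing 0ℓ (c ⊔ ℓ)
    expressions = record
      { Carrier = Polynomial n ; _≈_ = λ p q → ∀ ρ → ⟦ p ⟧ ρ ≈ ⟦ q ⟧ ρ
      ; _+_ = _:+_ ; _*_ = _:*_ ; -_ = :-_ ; 0# = con (+ 0) ; 1# = con (+ 1) }
    ⟦⟧-isRingMonomorphism : IsRingMonomorphism expressions (CommutativeRing.rawRing Functions) ⟦_⟧
    ⟦⟧-isRingMonomorphism = record
      { isRingHomomorphism = record
        { isSemiringHomomorphism = record
          { isNearSemiringHomomorphism = record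
            { +-isMonoidHomomorphism = record
              { isMagmaHomomorphism = record
                { isRelHomomorphism = record { cong = λ p≈q → p≈q }
                ; homo = λ _ _ _ → refl }
              ; ε-homo = λ _ → refl }
            ; *-homo = λ _ _ _ → refl }
          ; 1#-homo = λ _ → refl }
        ; -‿homo = λ _ _ → refl }
      ; injective = λ p≈q → p≈q }

module Matrices {c ℓ} (R : CommutativeRing c ℓ) where
  open CommutativeRing R hiding (zero) renaming (Carrier to K)
  open Geometry R

  infix  4 _≈ᵥ_
  infixl 6 _+ᵥ_
  infixr 7 _*ᵥ_
  infixl 8 _∙_

  _≈ᵥ_ : V3 → V3 → Set ℓ
  u ≈ᵥ v = (V3.x₁ u ≈ V3.x₁ v) × (V3.x₂ u ≈ V3.x₂ v) × (V3.x₃ u ≈ V3.x₃ v)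

  0ᵥ : V3
  0ᵥ = vec 0# 0# 0#

  _+ᵥ_ : V3 → V3 → V3
  vec a b d +ᵥ vec a′ b′ d′ = vec (a + a′) (b + b′) (d + d′)

  _*ᵥ_ : K → V3 → V3
  k *ᵥ vec a b d = vec (k * a) (k * b) (k * d)

  component : Fin 3 → V3 → K
  component zero             = V3.x₁
  component (suc zero)       = V3.x₂
  component (suc (suc zero)) = V3.x₃

  basis : Fin 3 → V3
  basis zero             = vec 1# 0# 0#
  basis (suc zero)       = vec 0# 1# 0#
  basis (suc (suc zero)) = vec 0# 0# 1#

  row : Fin 3 → Sym → V3
  row zero             (smat a b d e f g) = vec a b d
  row (suc zero)       (smat a b d e f g) = vec b e f
  row (suc (suc zero)) (smat a b d e f g) = vec d f g

  diag : Fin 3 → Sym → K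
  diag i M = component i (row i M)

  _∙_ : Sym → V3 → V3
  M ∙ x = vec (dot (row zero M) x) (dot (row (suc zero) M) x) (dot (row (suc (suc zero)) M) x)

  quadratic : Sym → V3 → K
  quadratic M x = dot (M ∙ x) x

  adj : Sym → Sym
  adj (smat a b d e f g) =
    smat (e * g - f * f) (d * f - b * g) (b * f - e * d) (a * g - d * d) (b * d - a * f) (a * e - b * b)

  -- adj (S + t R) = adj S + t · mixedAdj S R + t² · adj R
  mixedAdj : Sym → Sym → Sym
  mixedAdj (smat a b d e f g) (smat a′ b′ d′ e′ f′ g′) =
    smat (e * g′ + e′ * g - (f * f′ + f * f′)) (d * f′ + d′ * f - (b * g′ + b′ * g))
         (b * f′ + b′ * f - (e * d′ + e′ * d)) (a * g′ + a′ * g - (d * d′ + d * d′))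
         (b * d′ + b′ * d - (a * f′ + a′ * f)) (a * e′ + a′ * e - (b * b′ + b * b′))

  -- the trace form tr (A B)
  ⟨_,_⟩ : Sym → Sym → K
  ⟨ smat a b d e f g , smat a′ b′ d′ e′ f′ g′ ⟩ =
    let o = b * b′ + d * d′ + f * f′ in a * a′ + e * e′ + g * g′ + (o + o)

  -- For linear φ with matrix Φ, the terms k · φ(v) φ(v)ᵀ sum to Φ M Φᵀ.
  rankOneTerms : (V3 → V3) → Sym → List (K × V3)
  rankOneTerms φ (smat a b d e f g) =
    (a - b - d , φ e₁) ∷ (e - b - f , φ e₂) ∷ (g - d - f , φ e₃) ∷
    (b , φ (e₁ +ᵥ e₂)) ∷ (d , φ (e₁ +ᵥ e₃)) ∷ (f , φ (e₂ +ᵥ e₃)) ∷ []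
    where e₁ = basis zero; e₂ = basis (suc zero); e₃ = basis (suc (suc zero))

  All-rankOneTerms : ∀ {p} {P : V3 → Set p} φ M → (∀ v → P (φ v)) → All (λ t → P (proj₂ t)) (rankOneTerms φ M)
  All-rankOneTerms φ (smat a b d e f g) Pφ = Pφ _ ∷ Pφ _ ∷ Pφ _ ∷ Pφ _ ∷ Pφ _ ∷ Pφ _ ∷ []

  -- the matrix Π = I − y z wᵀ
  project : K → V3 → V3 → V3 → V3
  project y z w v = v +ᵥ (- (y * dot w v)) *ᵥ z

  -- Π M Πᵀ − M, written in terms of h = M w
  congruenceDefect : K → V3 → V3 → V3 → Sym
  congruenceDefect y z w h = comb (y * y * dot w h) (outer z) (- y) (symmetricProduct z h)
    where
    symmetricProduct : V3 → V3 → Sym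
    symmetricProduct (vec z₁ z₂ z₃) (vec h₁ h₂ h₃) =
      smat (z₁ * h₁ + h₁ * z₁) (z₁ * h₂ + h₁ * z₂) (z₁ * h₃ + h₁ * z₃)
           (z₂ * h₂ + h₂ * z₂) (z₂ * h₃ + h₂ * z₃) (z₃ * h₃ + h₃ * z₃)

module OverCommutativeRing {c ℓ} (F : CommutativeRing c ℓ) where
  open CommutativeRing F hiding (zero) renaming (Carrier to K)
  open Geometry F
  open Matrices F
  open IntegerCoefficients F
  open import Algebra.Properties.Ring ring using (-0#≈0#)
  open import Algebra.Properties.AbelianGroup +-abelianGroup using (⁻¹-anti-homo‿-)
  open import Relation.Binary.Reasoning.Setoid setoid

  module ᴾ {n : ℕ} where
    open CommutativeRing (Polynomials n) public using (0#; 1#)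
    open Geometry (Polynomials n) public
    open Matrices (Polynomials n) public

  private
    NormalFormsAgree : ∀ {n} {A : Set} → (A → Polynomial n) → A × A → Set _
    NormalFormsAgree {n} π (u , v) = Eqʰ n _≈_ (curryⁿ ⟦ π u ⟧↓) (curryⁿ ⟦ π v ⟧↓)

    agree⇒≈ : ∀ n p q → Eqʰ n _≈_ (curryⁿ ⟦ p ⟧↓) (curryⁿ ⟦ q ⟧↓) → ∀ ρ → ⟦ p ⟧ ρ ≈ ⟦ q ⟧ ρ
    agree⇒≈ n p q h ρ = prove ρ p q (curryⁿ-cong⁻¹ _≈_ ⟦ p ⟧↓ ⟦ q ⟧↓ (Eqʰ-to-Eq n _≈_ h) ρ)

    evalᵥ : ∀ {n} → ᴾ.V3 {n} → Vec K n → V3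
    evalᵥ v ρ = vec (⟦ ᴾ.V3.x₁ v ⟧ ρ) (⟦ ᴾ.V3.x₂ v ⟧ ρ) (⟦ ᴾ.V3.x₃ v ⟧ ρ)

    evalₛ : ∀ {n} → ᴾ.Sym {n} → Vec K n → Sym
    evalₛ (ᴾ.smat a b d e f g) ρ = smat (⟦ a ⟧ ρ) (⟦ b ⟧ ρ) (⟦ d ⟧ ρ) (⟦ e ⟧ ρ) (⟦ f ⟧ ρ) (⟦ g ⟧ ρ)

  solveᵥ : ∀ n (f : N-ary n (Polynomial n) (ᴾ.V3 × ᴾ.V3)) →
    NormalFormsAgree ᴾ.V3.x₁ (close n f) → NormalFormsAgree ᴾ.V3.x₂ (close n f) →
    NormalFormsAgree ᴾ.V3.x₃ (close n f) →
    Eq n _≈ᵥ_ (curryⁿ (evalᵥ (proj₁ (close n f)))) (curryⁿ (evalᵥ (proj₂ (close n f))))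
  solveᵥ n f h₁ h₂ h₃ = curryⁿ-cong _≈ᵥ_ (evalᵥ u) (evalᵥ v) λ ρ →
    agree⇒≈ n (ᴾ.V3.x₁ u) (ᴾ.V3.x₁ v) h₁ ρ , agree⇒≈ n (ᴾ.V3.x₂ u) (ᴾ.V3.x₂ v) h₂ ρ ,
    agree⇒≈ n (ᴾ.V3.x₃ u) (ᴾ.V3.x₃ v) h₃ ρ
    where
    u = proj₁ (close n f)
    v = proj₂ (close n f)

  solveₛ : ∀ n (f : N-ary n (Polynomial n) (ᴾ.Sym × ᴾ.Sym)) →
    NormalFormsAgree ᴾ.Sym.a11 (close n f) → NormalFormsAgree ᴾ.Sym.a12 (close n f) →
    NormalFormsAgree ᴾ.Sym.a13 (close n f) → NormalFormsAgree ᴾ.Sym.a22 (close n f) →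
    NormalFormsAgree ᴾ.Sym.a23 (close n f) → NormalFormsAgree ᴾ.Sym.a33 (close n f) →
    Eq n _≈S_ (curryⁿ (evalₛ (proj₁ (close n f)))) (curryⁿ (evalₛ (proj₂ (close n f))))
  solveₛ n f h₁₁ h₁₂ h₁₃ h₂₂ h₂₃ h₃₃ = curryⁿ-cong _≈S_ (evalₛ M) (evalₛ N) λ ρ →
    agree⇒≈ n (ᴾ.Sym.a11 M) (ᴾ.Sym.a11 N) h₁₁ ρ , agree⇒≈ n (ᴾ.Sym.a12 M) (ᴾ.Sym.a12 N) h₁₂ ρ ,
    agree⇒≈ n (ᴾ.Sym.a13 M) (ᴾ.Sym.a13 N) h₁₃ ρ , agree⇒≈ n (ᴾ.Sym.a22 M) (ᴾ.Sym.a22 N) h₂₂ ρ ,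
    agree⇒≈ n (ᴾ.Sym.a23 M) (ᴾ.Sym.a23 N) h₂₃ ρ , agree⇒≈ n (ᴾ.Sym.a33 M) (ᴾ.Sym.a33 N) h₃₃ ρ
    where
    M = proj₁ (close n f)
    N = proj₂ (close n f)

  x≈0⇒x*y≈0 : ∀ {x y} → x ≈ 0# → x * y ≈ 0#
  x≈0⇒x*y≈0 {x} {y} x≈0 = trans (*-congʳ x≈0) (zeroˡ y)

  y≈0⇒x*y≈0 : ∀ {x y} → y ≈ 0# → x * y ≈ 0#
  y≈0⇒x*y≈0 {x} {y} y≈0 = trans (*-congˡ y≈0) (zeroʳ x)

  x≈0∧y≈0⇒x+y≈0 : ∀ {x y} → x ≈ 0# → y ≈ 0# → x + y ≈ 0#
  x≈0∧y≈0⇒x+y≈0 x≈0 y≈0 = trans (+-cong x≈0 y≈0) (+-identityʳ 0#)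

  x*u-y*v≈0 : ∀ {x y u v} → u ≈ 0# → v ≈ 0# → x * u - y * v ≈ 0#
  x*u-y*v≈0 u≈0 v≈0 = trans (+-cong (y≈0⇒x*y≈0 u≈0) (-‿cong (y≈0⇒x*y≈0 v≈0))) (-‿inverseʳ 0#)

  x-y≈0⇒y-x≈0 : ∀ {x y} → x - y ≈ 0# → y - x ≈ 0#
  x-y≈0⇒y-x≈0 {x} {y} x-y≈0 = trans (sym (⁻¹-anti-homo‿- x y)) (trans (-‿cong x-y≈0) -0#≈0#)

  ≈ᵥ-sym : ∀ {u v} → u ≈ᵥ v → v ≈ᵥ u
  ≈ᵥ-sym (p₁ , p₂ , p₃) = sym p₁ , sym p₂ , sym p₃

  ≈ᵥ-trans : ∀ {u v w} → u ≈ᵥ v → v ≈ᵥ w → u ≈ᵥ w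
  ≈ᵥ-trans (p₁ , p₂ , p₃) (q₁ , q₂ , q₃) = trans p₁ q₁ , trans p₂ q₂ , trans p₃ q₃

  ≈S-sym : ∀ {M N} → M ≈S N → N ≈S M
  ≈S-sym (p₁ , p₂ , p₃ , p₄ , p₅ , p₆) = sym p₁ , sym p₂ , sym p₃ , sym p₄ , sym p₅ , sym p₆

  ≈S-trans : ∀ {M N P} → M ≈S N → N ≈S P → M ≈S P
  ≈S-trans (p₁ , p₂ , p₃ , p₄ , p₅ , p₆) (q₁ , q₂ , q₃ , q₄ , q₅ , q₆) =
    trans p₁ q₁ , trans p₂ q₂ , trans p₃ q₃ , trans p₄ q₄ , trans p₅ q₅ , trans p₆ q₆

  +ᵥ-zero : ∀ {u v} → u ≈ᵥ 0ᵥ → v ≈ᵥ 0ᵥ → u +ᵥ v ≈ᵥ 0ᵥ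
  +ᵥ-zero {vec _ _ _} {vec _ _ _} (p₁ , p₂ , p₃) (q₁ , q₂ , q₃) =
    x≈0∧y≈0⇒x+y≈0 p₁ q₁ , x≈0∧y≈0⇒x+y≈0 p₂ q₂ , x≈0∧y≈0⇒x+y≈0 p₃ q₃

  +ᵥ-vanishingʳ : ∀ {u v} → v ≈ᵥ 0ᵥ → u +ᵥ v ≈ᵥ u
  +ᵥ-vanishingʳ {vec a b d} {vec _ _ _} (p₁ , p₂ , p₃) =
    trans (+-congˡ p₁) (+-identityʳ a) , trans (+-congˡ p₂) (+-identityʳ b) , trans (+-congˡ p₃) (+-identityʳ d)

  *ᵥ-zeroˡ : ∀ {k} v → k ≈ 0# → k *ᵥ v ≈ᵥ 0ᵥ
  *ᵥ-zeroˡ (vec _ _ _) k≈0 = x≈0⇒x*y≈0 k≈0 , x≈0⇒x*y≈0 k≈0 , x≈0⇒x*y≈0 k≈0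

  *ᵥ-zeroʳ : ∀ k {v} → v ≈ᵥ 0ᵥ → k *ᵥ v ≈ᵥ 0ᵥ
  *ᵥ-zeroʳ k {vec _ _ _} (p₁ , p₂ , p₃) = y≈0⇒x*y≈0 p₁ , y≈0⇒x*y≈0 p₂ , y≈0⇒x*y≈0 p₃

  dot-congˡ : ∀ {u v} x → u ≈ᵥ v → dot u x ≈ dot v x
  dot-congˡ x (p₁ , p₂ , p₃) = +-cong (+-cong (*-congʳ p₁) (*-congʳ p₂)) (*-congʳ p₃)

  dot-zeroˡ : ∀ {u} x → u ≈ᵥ 0ᵥ → dot u x ≈ 0#
  dot-zeroˡ x (p₁ , p₂ , p₃) =
    x≈0∧y≈0⇒x+y≈0 (x≈0∧y≈0⇒x+y≈0 (x≈0⇒x*y≈0 p₁) (x≈0⇒x*y≈0 p₂)) (x≈0⇒x*y≈0 p₃)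

  dot-zeroʳ : ∀ {v} w → v ≈ᵥ 0ᵥ → dot w v ≈ 0#
  dot-zeroʳ w (p₁ , p₂ , p₃) =
    x≈0∧y≈0⇒x+y≈0 (x≈0∧y≈0⇒x+y≈0 (y≈0⇒x*y≈0 p₁) (y≈0⇒x*y≈0 p₂)) (y≈0⇒x*y≈0 p₃)

  ∙-cong : ∀ {M N} x → M ≈S N → M ∙ x ≈ᵥ N ∙ x
  ∙-cong x (p₁₁ , p₁₂ , p₁₃ , p₂₂ , p₂₃ , p₃₃) =
    dot-congˡ x (p₁₁ , p₁₂ , p₁₃) , dot-congˡ x (p₁₂ , p₂₂ , p₂₃) , dot-congˡ x (p₁₃ , p₂₃ , p₃₃)

  det-cong : ∀ {M N} → M ≈S N → det M ≈ det N
  det-cong (a , b , d , e , f , g) =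
    +-cong (−-cong (*-cong a (−-cong (*-cong e g) (*-cong f f))) (*-cong b (−-cong (*-cong b g) (*-cong f d))))
           (*-cong d (−-cong (*-cong b f) (*-cong e d)))
    where
    −-cong : ∀ {x x′ y y′} → x ≈ x′ → y ≈ y′ → x - y ≈ x′ - y′
    −-cong x≈x′ y≈y′ = +-cong x≈x′ (-‿cong y≈y′)

  +S-vanishingʳ : ∀ M {N} → N ≈S zeroS → (M +S N) ≈S M
  +S-vanishingʳ (smat _ _ _ _ _ _) (p₁ , p₂ , p₃ , p₄ , p₅ , p₆) = v p₁ , v p₂ , v p₃ , v p₄ , v p₅ , v p₆
    where
    v : ∀ {x y} → y ≈ 0# → x + y ≈ x
    v {x} y≈0 = trans (+-congˡ y≈0) (+-identityʳ x)

  comb-vanishingˡ : ∀ {α} N β M → α ≈ 0# → comb α N β M ≈S (β ·S M)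
  comb-vanishingˡ {α} (smat _ _ _ _ _ _) β (smat _ _ _ _ _ _) α≈0 = v , v , v , v , v , v
    where
    v : ∀ {r o} → α * r + β * o ≈ β * o
    v {o = o} = trans (+-congʳ (x≈0⇒x*y≈0 α≈0)) (+-identityˡ (β * o))

  outer-∙ : ∀ u x → outer u ∙ x ≈ᵥ dot u x *ᵥ u
  outer-∙ (vec a b d) (vec x y z) = solveᵥ 6 (λ a b d x y z →
      let u = ᴾ.vec a b d; v = ᴾ.vec x y z in ᴾ.outer u ᴾ.∙ v , ᴾ.dot u v ᴾ.*ᵥ u)
    refl refl refl a b d x y z

  zeroS-∙ : ∀ w → zeroS ∙ w ≈ᵥ 0ᵥ
  zeroS-∙ (vec x y z) = solveᵥ 3 (λ x y z → ᴾ.zeroS ᴾ.∙ ᴾ.vec x y z , ᴾ.0ᵥ) refl refl refl x y z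

  comb-∙ : ∀ α A β B x → comb α A β B ∙ x ≈ᵥ α *ᵥ (A ∙ x) +ᵥ β *ᵥ (B ∙ x)
  comb-∙ α (smat a b d e f g) β (smat a′ b′ d′ e′ f′ g′) (vec x y z) =
    solveᵥ 17 (λ α a b d e f g β a′ b′ d′ e′ f′ g′ x y z →
      let A = ᴾ.smat a b d e f g; B = ᴾ.smat a′ b′ d′ e′ f′ g′; v = ᴾ.vec x y z in
      ᴾ.comb α A β B ᴾ.∙ v , α ᴾ.*ᵥ (A ᴾ.∙ v) ᴾ.+ᵥ β ᴾ.*ᵥ (B ᴾ.∙ v))
    refl refl refl α a b d e f g β a′ b′ d′ e′ f′ g′ x y z

  comb-outer-∙ : ∀ α R β x →
    comb α R β (outer (R ∙ x)) ∙ x ≈ᵥ α *ᵥ (R ∙ x) +ᵥ (β * quadratic R x) *ᵥ (R ∙ x)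
  comb-outer-∙ α (smat a b d e f g) β (vec x y z) =
    solveᵥ 11 (λ α a b d e f g β x y z →
      let R = ᴾ.smat a b d e f g; v = ᴾ.vec x y z in
      ᴾ.comb α R β (ᴾ.outer (R ᴾ.∙ v)) ᴾ.∙ v , α ᴾ.*ᵥ (R ᴾ.∙ v) ᴾ.+ᵥ (β :* ᴾ.quadratic R v) ᴾ.*ᵥ (R ᴾ.∙ v))
    refl refl refl α a b d e f g β x y z

  outer+S-∙ : ∀ k u N w → ((k ·S outer u) +S N) ∙ w ≈ᵥ (k * dot w u) *ᵥ u +ᵥ N ∙ w
  outer+S-∙ k (vec u₁ u₂ u₃) (smat a b d e f g) (vec w₁ w₂ w₃) =
    solveᵥ 13 (λ k u₁ u₂ u₃ a b d e f g w₁ w₂ w₃ →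
      let u = ᴾ.vec u₁ u₂ u₃; N = ᴾ.smat a b d e f g; w = ᴾ.vec w₁ w₂ w₃ in
      ((k ᴾ.·S ᴾ.outer u) ᴾ.+S N) ᴾ.∙ w , (k :* ᴾ.dot w u) ᴾ.*ᵥ u ᴾ.+ᵥ N ᴾ.∙ w)
    refl refl refl k u₁ u₂ u₃ a b d e f g w₁ w₂ w₃

  ∙-symmetric : ∀ M w x → dot w (M ∙ x) ≈ dot (M ∙ w) x
  ∙-symmetric (smat a b d e f g) (vec w₁ w₂ w₃) (vec x y z) =
    solve 12 (λ a b d e f g w₁ w₂ w₃ x y z →
      let M = ᴾ.smat a b d e f g; w = ᴾ.vec w₁ w₂ w₃; v = ᴾ.vec x y z in
      ᴾ.dot w (M ᴾ.∙ v) := ᴾ.dot (M ᴾ.∙ w) v)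
    refl a b d e f g w₁ w₂ w₃ x y z

  dot-*ᵥ : ∀ k u x → dot (k *ᵥ u) x ≈ k * dot u x
  dot-*ᵥ k (vec a b d) (vec x y z) = solve 7 (λ k a b d x y z →
      let u = ᴾ.vec a b d; v = ᴾ.vec x y z in ᴾ.dot (k ᴾ.*ᵥ u) v := k :* ᴾ.dot u v)
    refl k a b d x y z

  dot-basis : ∀ i w → dot w (basis i) ≈ component i w
  dot-basis zero (vec a b d) =
    solve 3 (λ a b d → ᴾ.dot (ᴾ.vec a b d) (ᴾ.basis zero) := a) refl a b d
  dot-basis (suc zero) (vec a b d) =
    solve 3 (λ a b d → ᴾ.dot (ᴾ.vec a b d) (ᴾ.basis (suc zero)) := b) refl a b d
  dot-basis (suc (suc zero)) (vec a b d) =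
    solve 3 (λ a b d → ᴾ.dot (ᴾ.vec a b d) (ᴾ.basis (suc (suc zero))) := d) refl a b d

  det-pencil : ∀ S R t →
    det (S +S (t ·S R)) ≈ det S + t * ⟨ adj S , R ⟩ + t * t * ⟨ S , adj R ⟩ + t * t * t * det R
  det-pencil (smat a b d e f g) (smat a′ b′ d′ e′ f′ g′) t =
    solve 13 (λ a b d e f g a′ b′ d′ e′ f′ g′ t →
      let S = ᴾ.smat a b d e f g; R = ᴾ.smat a′ b′ d′ e′ f′ g′ in
      ᴾ.det (S ᴾ.+S (t ᴾ.·S R)) :=
      ᴾ.det S :+ t :* ᴾ.⟨ ᴾ.adj S , R ⟩ :+ t :* t :* ᴾ.⟨ S , ᴾ.adj R ⟩ :+ t :* t :* t :* ᴾ.det R)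
    refl a b d e f g a′ b′ d′ e′ f′ g′ t

  adj-adj : ∀ S → adj (adj S) ≈S (det S ·S S)
  adj-adj (smat a b d e f g) = solveₛ 6 (λ a b d e f g →
      let S = ᴾ.smat a b d e f g in ᴾ.adj (ᴾ.adj S) , ᴾ.det S ᴾ.·S S)
    refl refl refl refl refl refl a b d e f g

  adj-row-kernel : ∀ i S → S ∙ row i (adj S) ≈ᵥ det S *ᵥ basis i
  adj-row-kernel zero (smat a b d e f g) = solveᵥ 6 (λ a b d e f g →
      let S = ᴾ.smat a b d e f g in S ᴾ.∙ ᴾ.row zero (ᴾ.adj S) , ᴾ.det S ᴾ.*ᵥ ᴾ.basis zero)
    refl refl refl a b d e f g
  adj-row-kernel (suc zero) (smat a b d e f g) = solveᵥ 6 (λ a b d e f g →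
      let S = ᴾ.smat a b d e f g in S ᴾ.∙ ᴾ.row (suc zero) (ᴾ.adj S) , ᴾ.det S ᴾ.*ᵥ ᴾ.basis (suc zero))
    refl refl refl a b d e f g
  adj-row-kernel (suc (suc zero)) (smat a b d e f g) = solveᵥ 6 (λ a b d e f g →
      let S = ᴾ.smat a b d e f g in
      S ᴾ.∙ ᴾ.row (suc (suc zero)) (ᴾ.adj S) , ᴾ.det S ᴾ.*ᵥ ᴾ.basis (suc (suc zero)))
    refl refl refl a b d e f g

  quadratic-adj-row : ∀ i S R →
    quadratic R (row i (adj S)) ≈ diag i (adj S) * ⟨ adj S , R ⟩ - diag i (mixedAdj S R) * det S
  quadratic-adj-row zero (smat a b d e f g) (smat a′ b′ d′ e′ f′ g′) =
    solve 12 (λ a b d e f g a′ b′ d′ e′ f′ g′ →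
      let S = ᴾ.smat a b d e f g; R = ᴾ.smat a′ b′ d′ e′ f′ g′ in
      ᴾ.quadratic R (ᴾ.row zero (ᴾ.adj S)) :=
      ᴾ.diag zero (ᴾ.adj S) :* ᴾ.⟨ ᴾ.adj S , R ⟩ :- ᴾ.diag zero (ᴾ.mixedAdj S R) :* ᴾ.det S)
    refl a b d e f g a′ b′ d′ e′ f′ g′
  quadratic-adj-row (suc zero) (smat a b d e f g) (smat a′ b′ d′ e′ f′ g′) =
    solve 12 (λ a b d e f g a′ b′ d′ e′ f′ g′ →
      let S = ᴾ.smat a b d e f g; R = ᴾ.smat a′ b′ d′ e′ f′ g′ in
      ᴾ.quadratic R (ᴾ.row (suc zero) (ᴾ.adj S)) :=
      ᴾ.diag (suc zero) (ᴾ.adj S) :* ᴾ.⟨ ᴾ.adj S , R ⟩ :- ᴾ.diag (suc zero) (ᴾ.mixedAdj S R) :* ᴾ.det S)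
    refl a b d e f g a′ b′ d′ e′ f′ g′
  quadratic-adj-row (suc (suc zero)) (smat a b d e f g) (smat a′ b′ d′ e′ f′ g′) =
    solve 12 (λ a b d e f g a′ b′ d′ e′ f′ g′ →
      let S = ᴾ.smat a b d e f g; R = ᴾ.smat a′ b′ d′ e′ f′ g′ in
      ᴾ.quadratic R (ᴾ.row (suc (suc zero)) (ᴾ.adj S)) :=
      ᴾ.diag (suc (suc zero)) (ᴾ.adj S) :* ᴾ.⟨ ᴾ.adj S , R ⟩ :- ᴾ.diag (suc (suc zero)) (ᴾ.mixedAdj S R) :* ᴾ.det S)
    refl a b d e f g a′ b′ d′ e′ f′ g′

  pencil-comb : ∀ σ₁ σ₂ l m A B t →
    (comb σ₁ A σ₂ B +S (t ·S comb l A m B)) ≈S comb (σ₁ + t * l) A (σ₂ + t * m) B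
  pencil-comb σ₁ σ₂ l m (smat a b d e f g) (smat a′ b′ d′ e′ f′ g′) t =
    solveₛ 17 (λ σ₁ σ₂ l m a b d e f g a′ b′ d′ e′ f′ g′ t →
      let A = ᴾ.smat a b d e f g; B = ᴾ.smat a′ b′ d′ e′ f′ g′ in
      ᴾ.comb σ₁ A σ₂ B ᴾ.+S (t ᴾ.·S ᴾ.comb l A m B) , ᴾ.comb (σ₁ :+ t :* l) A (σ₂ :+ t :* m) B)
    refl refl refl refl refl refl σ₁ σ₂ l m a b d e f g a′ b′ d′ e′ f′ g′ t

  comb-1-0 : ∀ M N → M ≈S comb 1# M 0# N
  comb-1-0 (smat a b d e f g) (smat a′ b′ d′ e′ f′ g′) =
    solveₛ 12 (λ a b d e f g a′ b′ d′ e′ f′ g′ →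
      let M = ᴾ.smat a b d e f g; N = ᴾ.smat a′ b′ d′ e′ f′ g′ in M , ᴾ.comb ᴾ.1# M ᴾ.0# N)
    refl refl refl refl refl refl a b d e f g a′ b′ d′ e′ f′ g′

  comb-0-1 : ∀ M N → N ≈S comb 0# M 1# N
  comb-0-1 (smat a b d e f g) (smat a′ b′ d′ e′ f′ g′) =
    solveₛ 12 (λ a b d e f g a′ b′ d′ e′ f′ g′ →
      let M = ᴾ.smat a b d e f g; N = ᴾ.smat a′ b′ d′ e′ f′ g′ in N , ᴾ.comb ᴾ.0# M ᴾ.1# N)
    refl refl refl refl refl refl a b d e f g a′ b′ d′ e′ f′ g′

  outer≈sumOuter : ∀ u → outer u ≈S sumOuter ((1# , u) ∷ [])
  outer≈sumOuter (vec a b d) = solveₛ 3 (λ a b d →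
      ᴾ.outer (ᴾ.vec a b d) , ᴾ.sumOuter ((ᴾ.1# , ᴾ.vec a b d) ∷ []))
    refl refl refl refl refl refl a b d

  rankOneTerms-project : ∀ y z w M →
    sumOuter (rankOneTerms (project y z w) M) ≈S (M +S congruenceDefect y z w (M ∙ w))
  rankOneTerms-project y (vec z₁ z₂ z₃) (vec w₁ w₂ w₃) (smat a b d e f g) =
    solveₛ 13 (λ y z₁ z₂ z₃ w₁ w₂ w₃ a b d e f g →
      let z = ᴾ.vec z₁ z₂ z₃; w = ᴾ.vec w₁ w₂ w₃; M = ᴾ.smat a b d e f g in
      ᴾ.sumOuter (ᴾ.rankOneTerms (ᴾ.project y z w) M) , M ᴾ.+S ᴾ.congruenceDefect y z w (M ᴾ.∙ w))
    refl refl refl refl refl refl y z₁ z₂ z₃ w₁ w₂ w₃ a b d e f g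

  dot-project : ∀ y z w v → dot w (project y z w v) ≈ dot w v * (1# - y * dot w z)
  dot-project y (vec z₁ z₂ z₃) (vec w₁ w₂ w₃) (vec v₁ v₂ v₃) =
    solve 10 (λ y z₁ z₂ z₃ w₁ w₂ w₃ v₁ v₂ v₃ →
      let z = ᴾ.vec z₁ z₂ z₃; w = ᴾ.vec w₁ w₂ w₃; v = ᴾ.vec v₁ v₂ v₃ in
      ᴾ.dot w (ᴾ.project y z w v) := ᴾ.dot w v :* (ᴾ.1# :- y :* ᴾ.dot w z))
    refl y z₁ z₂ z₃ w₁ w₂ w₃ v₁ v₂ v₃

  project-orthogonal : ∀ {y z w} → dot w z * y ≈ 1# → ∀ v → OnLine w (project y z w v)
  project-orthogonal {y} {z} {w} wz·y≈1 v = trans (dot-project y z w v) (y≈0⇒x*y≈0 (begin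
    1# - y * dot w z   ≈⟨ +-congˡ (-‿cong (trans (*-comm y (dot w z)) wz·y≈1)) ⟩
    1# - 1#            ≈⟨ -‿inverseʳ 1# ⟩
    0#                 ∎))

  congruenceDefect-vanishes : ∀ y z w {h} → h ≈ᵥ 0ᵥ → congruenceDefect y z w h ≈S zeroS
  congruenceDefect-vanishes y (vec _ _ _) w {vec _ _ _} h≈0@(h₁ , h₂ , h₃) =
    v h₁ h₁ , v h₁ h₂ , v h₁ h₃ , v h₂ h₂ , v h₂ h₃ , v h₃ h₃
    where
    v : ∀ {o s t p q} → p ≈ 0# → q ≈ 0# → (y * y * dot w _) * o + - y * (s * q + p * t) ≈ 0#
    v p≈0 q≈0 = x≈0∧y≈0⇒x+y≈0 (x≈0⇒x*y≈0 (y≈0⇒x*y≈0 (dot-zeroʳ w h≈0)))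
                               (y≈0⇒x*y≈0 (x≈0∧y≈0⇒x+y≈0 (y≈0⇒x*y≈0 q≈0) (x≈0⇒x*y≈0 p≈0)))

  sumOuter-∙ : ∀ {w} ts → All (λ t → OnLine w (proj₂ t)) ts → sumOuter ts ∙ w ≈ᵥ 0ᵥ
  sumOuter-∙ {w} [] [] = zeroS-∙ w
  sumOuter-∙ {w} ((k , u) ∷ ts) (wu≈0 ∷ on) =
    ≈ᵥ-trans (outer+S-∙ k u (sumOuter ts) w) (+ᵥ-zero (*ᵥ-zeroˡ u (y≈0⇒x*y≈0 wu≈0)) (sumOuter-∙ ts on))

  conicPlane⇒kernel : ∀ {w M} → InConicPlane w M → M ∙ w ≈ᵥ 0ᵥ
  conicPlane⇒kernel {w} (ts , on , M≈sum) = ≈ᵥ-trans (∙-cong w M≈sum) (sumOuter-∙ ts on)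

  outer∈conicPlane : ∀ {w u} → OnLine w u → InConicPlane w (outer u)
  outer∈conicPlane {u = u} wu≈0 = (1# , u) ∷ [] , wu≈0 ∷ [] , outer≈sumOuter u

  singular-pencil : ∀ {S R} → det S ≈ 0# → det R ≈ 0# →
    ∀ t → det (S +S (t ·S R)) ≈ t * (⟨ adj S , R ⟩ + t * ⟨ S , adj R ⟩)
  singular-pencil {S} {R} detS≈0 detR≈0 t = begin
    det (S +S (t ·S R))                              ≈⟨ det-pencil S R t ⟩
    det S + t * c₁ + t * t * c₂ + t * t * t * det R  ≈⟨ +-cong (+-congʳ (+-congʳ detS≈0)) (y≈0⇒x*y≈0 detR≈0) ⟩
    0# + t * c₁ + t * t * c₂ + 0#                    ≈⟨ solve 3 (λ t c₁ c₂ →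
                                                          ᴾ.0# :+ t :* c₁ :+ t :* t :* c₂ :+ ᴾ.0# := t :* (c₁ :+ t :* c₂))
                                                        refl t c₁ c₂ ⟩
    t * (c₁ + t * c₂)                                ∎
    where c₁ = ⟨ adj S , R ⟩; c₂ = ⟨ S , adj R ⟩

  adj≈0⇒AllMinorsZero : ∀ S → adj S ≈S zeroS → AllMinorsZero S
  adj≈0⇒AllMinorsZero (smat a b d e f g) (p₁₁ , p₁₂ , p₁₃ , p₂₂ , p₂₃ , p₃₃) =
    p₃₃ , trans (+-congˡ (-‿cong (*-comm d b))) (x-y≈0⇒y-x≈0 p₂₃) , trans (+-congˡ (-‿cong (*-comm d e))) p₁₃ ,
    x-y≈0⇒y-x≈0 p₂₃ , p₂₂ , x-y≈0⇒y-x≈0 p₁₂ ,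
    p₁₃ , trans (+-congˡ (-‿cong (*-comm f d))) (x-y≈0⇒y-x≈0 p₁₂) , p₁₁

module OverField {c ℓ} (F : CommutativeRing c ℓ) (isField : Geometry.IsField F)
                 (_≟_ : Decidable (CommutativeRing._≈_ F)) where
  open CommutativeRing F hiding (zero) renaming (Carrier to K)
  open Geometry F
  open Matrices F
  open OverCommutativeRing F
  open IntegerCoefficients F using (solve; _:=_; _:+_; _:*_; _:-_; :-_)
  open import Algebra.Properties.Ring ring using (-0#≈0#)
  open import Algebra.Properties.Group +-group using (x∙y⁻¹≈ε⇒x≈y)
  open import Data.Fin.Properties using (¬∀⟶∃¬)
  open import Relation.Binary.Reasoning.Setoid setoid

  x≉0∧x*y≈0⇒y≈0 : ∀ {x y} → x ≉ 0# → x * y ≈ 0# → y ≈ 0#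
  x≉0∧x*y≈0⇒y≈0 {x} {y} x≉0 xy≈0 = let (x⁻¹ , x·x⁻¹≈1) = proj₂ isField x x≉0 in begin
    y              ≈⟨ *-identityˡ y ⟨
    1# * y         ≈⟨ *-congʳ x·x⁻¹≈1 ⟨
    (x * x⁻¹) * y  ≈⟨ solve 3 (λ x x⁻¹ y → (x :* x⁻¹) :* y := x⁻¹ :* (x :* y)) refl x x⁻¹ y ⟩
    x⁻¹ * (x * y)  ≈⟨ y≈0⇒x*y≈0 xy≈0 ⟩
    0#             ∎

  x*x≈0⇒x≈0 : ∀ {x} → x * x ≈ 0# → x ≈ 0#
  x*x≈0⇒x≈0 {x} xx≈0 with x ≟ 0#
  ... | yes x≈0 = x≈0
  ... | no  x≉0 = x≉0∧x*y≈0⇒y≈0 x≉0 xx≈0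

  singular-2×2 : ∀ {x y z} → x ≈ 0# → x * y - z * z ≈ 0# → z ≈ 0#
  singular-2×2 {x} {y} {z} x≈0 det≈0 = x*x≈0⇒x≈0 (begin
    z * z                    ≈⟨ solve 3 (λ x y z → z :* z := x :* y :- (x :* y :- z :* z)) refl x y z ⟩
    x * y - (x * y - z * z)  ≈⟨ +-cong (x≈0⇒x*y≈0 x≈0) (-‿cong det≈0) ⟩
    0# - 0#                  ≈⟨ -‿inverseʳ 0# ⟩
    0#                       ∎)

  cramer : ∀ {σ₁ σ₂ l m a b} → σ₁ * m - σ₂ * l ≉ 0# →
    σ₁ * a + σ₂ * b ≈ 0# → l * a + m * b ≈ 0# → a ≈ 0# × b ≈ 0#
  cramer {σ₁} {σ₂} {l} {m} {a} {b} D≉0 p q =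
    x≉0∧x*y≈0⇒y≈0 D≉0 (begin
      (σ₁ * m - σ₂ * l) * a                         ≈⟨ solve 6 (λ σ₁ σ₂ l m a b →
          (σ₁ :* m :- σ₂ :* l) :* a := m :* (σ₁ :* a :+ σ₂ :* b) :- σ₂ :* (l :* a :+ m :* b)) refl σ₁ σ₂ l m a b ⟩
      m * (σ₁ * a + σ₂ * b) - σ₂ * (l * a + m * b)  ≈⟨ x*u-y*v≈0 p q ⟩
      0#                                            ∎) ,
    x≉0∧x*y≈0⇒y≈0 D≉0 (begin
      (σ₁ * m - σ₂ * l) * b                         ≈⟨ solve 6 (λ σ₁ σ₂ l m a b →
          (σ₁ :* m :- σ₂ :* l) :* b := σ₁ :* (l :* a :+ m :* b) :- l :* (σ₁ :* a :+ σ₂ :* b)) refl σ₁ σ₂ l m a b ⟩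
      σ₁ * (l * a + m * b) - l * (σ₁ * a + σ₂ * b)  ≈⟨ x*u-y*v≈0 q p ⟩
      0#                                            ∎)

  linear-two-roots : ∀ {t₁ t₂ a b} → t₁ ≉ t₂ → a + t₁ * b ≈ 0# → a + t₂ * b ≈ 0# → a ≈ 0#
  linear-two-roots {t₁} {t₂} {a} {b} t₁≉t₂ p q =
    x≉0∧x*y≈0⇒y≈0 (λ t₂-t₁≈0 → t₁≉t₂ (sym (x∙y⁻¹≈ε⇒x≈y t₂ t₁ t₂-t₁≈0))) (begin
      (t₂ - t₁) * a                          ≈⟨ solve 4 (λ t₁ t₂ a b →
          (t₂ :- t₁) :* a := t₂ :* (a :+ t₁ :* b) :- t₁ :* (a :+ t₂ :* b)) refl t₁ t₂ a b ⟩
      t₂ * (a + t₁ * b) - t₁ * (a + t₂ * b)  ≈⟨ x*u-y*v≈0 p q ⟩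
      0#                                     ∎)

  ∃component≉0 : ∀ {v} → NonzeroV v → Σ (Fin 3) λ i → component i v ≉ 0#
  ∃component≉0 {v} v≉0 = ¬∀⟶∃¬ 3 (λ i → component i v ≈ 0#) (λ i → component i v ≟ 0#)
    (λ v≈0 → v≉0 (v≈0 zero , v≈0 (suc zero) , v≈0 (suc (suc zero))))

  component≉0⇒NonzeroV : ∀ {v} i → component i v ≉ 0# → NonzeroV v
  component≉0⇒NonzeroV zero             vᵢ≉0 (v₁≈0 , _ , _) = vᵢ≉0 v₁≈0
  component≉0⇒NonzeroV (suc zero)       vᵢ≉0 (_ , v₂≈0 , _) = vᵢ≉0 v₂≈0
  component≉0⇒NonzeroV (suc (suc zero)) vᵢ≉0 (_ , _ , v₃≈0) = vᵢ≉0 v₃≈0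

  k*ᵥu≈0⇒k≈0 : ∀ {k u} → NonzeroV u → k *ᵥ u ≈ᵥ 0ᵥ → k ≈ 0#
  k*ᵥu≈0⇒k≈0 {k} {vec _ _ _} u≉0 (p₁ , p₂ , p₃) with k ≟ 0#
  ... | yes k≈0 = k≈0
  ... | no  k≉0 = ⊥-elim (u≉0 (x≉0∧x*y≈0⇒y≈0 k≉0 p₁ , x≉0∧x*y≈0⇒y≈0 k≉0 p₂ , x≉0∧x*y≈0⇒y≈0 k≉0 p₃))

  k·Souter≈0⇒k≈0 : ∀ {k u} → NonzeroV u → (k ·S outer u) ≈S zeroS → k ≈ 0#
  k·Souter≈0⇒k≈0 {k} {vec _ _ _} u≉0 (p₁₁ , _ , _ , p₂₂ , _ , p₃₃) with k ≟ 0#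
  ... | yes k≈0 = k≈0
  ... | no  k≉0 = ⊥-elim (u≉0 (x*x≈0⇒x≈0 (x≉0∧x*y≈0⇒y≈0 k≉0 p₁₁) ,
                               x*x≈0⇒x≈0 (x≉0∧x*y≈0⇒y≈0 k≉0 p₂₂) ,
                               x*x≈0⇒x≈0 (x≉0∧x*y≈0⇒y≈0 k≉0 p₃₃)))

  outer≈0·S⇒≈0 : ∀ {v k M} → outer v ≈S (k ·S M) → k ≈ 0# → v ≈ᵥ 0ᵥ
  outer≈0·S⇒≈0 {vec _ _ _} {M = smat _ _ _ _ _ _} (p₁₁ , _ , _ , p₂₂ , _ , p₃₃) k≈0 =
    x*x≈0⇒x≈0 (trans p₁₁ (x≈0⇒x*y≈0 k≈0)) ,
    x*x≈0⇒x≈0 (trans p₂₂ (x≈0⇒x*y≈0 k≈0)) ,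
    x*x≈0⇒x≈0 (trans p₃₃ (x≈0⇒x*y≈0 k≈0))

  -- For y (w · z) = 1, Π maps into w^⊥, and M = Π M Πᵀ because M w = 0.
  kernel⇒conicPlane : ∀ {w M} → NonzeroV w → M ∙ w ≈ᵥ 0ᵥ → InConicPlane w M
  kernel⇒conicPlane {w} {M} w≉0 Mw≈0 =
    let (i , wᵢ≉0) = ∃component≉0 w≉0
        z = basis i
        (y , wz·y≈1) = proj₂ isField (dot w z) (λ wz≈0 → wᵢ≉0 (trans (sym (dot-basis i w)) wz≈0))
    in rankOneTerms (project y z w) M ,
       All-rankOneTerms (project y z w) M (project-orthogonal wz·y≈1) ,
       ≈S-sym (≈S-trans (rankOneTerms-project y z w M) (+S-vanishingʳ M (congruenceDefect-vanishes y z w Mw≈0)))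

  adj-diag≈0⇒adj≈0 : ∀ {S} → det S ≈ 0# → (∀ i → diag i (adj S) ≈ 0#) → adj S ≈S zeroS
  adj-diag≈0⇒adj≈0 {S} detS≈0 diag≈0 = off-diagonal (adj-adj S)
    where
    vanish : ∀ {x y} → x ≈ det S * y → x ≈ 0#
    vanish x≈detS·y = trans x≈detS·y (x≈0⇒x*y≈0 detS≈0)
    off-diagonal : adj (adj S) ≈S (det S ·S S) → adj S ≈S zeroS
    off-diagonal (q₁₁ , _ , _ , q₂₂ , _ , q₃₃) =
      diag≈0 zero , singular-2×2 (diag≈0 zero) (vanish q₃₃) , singular-2×2 (diag≈0 zero) (vanish q₂₂) ,
      diag≈0 (suc zero) , singular-2×2 (diag≈0 (suc zero)) (vanish q₁₁) , diag≈0 (suc (suc zero))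

  ∃adj-diag≉0 : ∀ {S} → Rank2 S → Σ (Fin 3) λ i → diag i (adj S) ≉ 0#
  ∃adj-diag≉0 {S} (detS≈0 , ¬minors≈0) = ¬∀⟶∃¬ 3 (λ i → diag i (adj S) ≈ 0#) (λ i → diag i (adj S) ≟ 0#)
    (λ diag≈0 → ¬minors≈0 (adj≈0⇒AllMinorsZero S (adj-diag≈0⇒adj≈0 detS≈0 diag≈0)))

  -- A row of adj S with nonzero diagonal entry spans ker S, and adj S is a multiple of its outer square.
  rank2-kernel : ∀ {S} → Rank2 S →
    Σ V3 λ x → NonzeroV x × S ∙ x ≈ᵥ 0ᵥ × (∀ R → ⟨ adj S , R ⟩ ≈ 0# → quadratic R x ≈ 0#)
  rank2-kernel {S} rank2@(detS≈0 , _) =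
    let (i , adjᵢᵢ≉0) = ∃adj-diag≉0 rank2 in
    row i (adj S) , component≉0⇒NonzeroV i adjᵢᵢ≉0 ,
    ≈ᵥ-trans (adj-row-kernel i S) (*ᵥ-zeroˡ (basis i) detS≈0) ,
    λ R ⟨adjS,R⟩≈0 → trans (quadratic-adj-row i S R) (x*u-y*v≈0 ⟨adjS,R⟩≈0 detS≈0)

  module _ {R x} (isotropic : quadratic R x ≈ 0#) (Rx≉0 : NonzeroV (R ∙ x)) where

    comb-outer-∙-isotropic : ∀ α β → comb α R β (outer (R ∙ x)) ∙ x ≈ᵥ α *ᵥ (R ∙ x)
    comb-outer-∙-isotropic α β =
      ≈ᵥ-trans (comb-outer-∙ α R β x) (+ᵥ-vanishingʳ (*ᵥ-zeroˡ (R ∙ x) (y≈0⇒x*y≈0 isotropic)))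

    independent : Independent R (outer (R ∙ x))
    independent α β comb≈0 = α≈0 , k·Souter≈0⇒k≈0 Rx≉0 (≈S-trans (≈S-sym (comb-vanishingˡ R β _ α≈0)) comb≈0)
      where
      α≈0 : α ≈ 0#
      α≈0 = k*ᵥu≈0⇒k≈0 Rx≉0
        (≈ᵥ-trans (≈ᵥ-sym (comb-outer-∙-isotropic α β)) (≈ᵥ-trans (∙-cong x comb≈0) (zeroS-∙ x)))

    unique : ∀ v → NonzeroV v → OnLineThrough R (outer (R ∙ x)) (outer v) → SamePoint (outer v) (outer (R ∙ x))
    unique v v≉0 (α , β , v≈comb) = β , (λ β≈0 → v≉0 (outer≈0·S⇒≈0 v≈β·u β≈0)) , v≈β·u
      where
      vx·v≈α·u : dot v x *ᵥ v ≈ᵥ α *ᵥ (R ∙ x)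
      vx·v≈α·u = ≈ᵥ-trans (≈ᵥ-sym (outer-∙ v x)) (≈ᵥ-trans (∙-cong x v≈comb) (comb-outer-∙-isotropic α β))
      vx≈0 : dot v x ≈ 0#
      vx≈0 = x*x≈0⇒x≈0 (begin
        dot v x * dot v x     ≈⟨ dot-*ᵥ (dot v x) v x ⟨
        dot (dot v x *ᵥ v) x  ≈⟨ dot-congˡ x vx·v≈α·u ⟩
        dot (α *ᵥ (R ∙ x)) x  ≈⟨ dot-*ᵥ α (R ∙ x) x ⟩
        α * quadratic R x     ≈⟨ y≈0⇒x*y≈0 isotropic ⟩
        0#                    ∎)
      v≈β·u : outer v ≈S (β ·S outer (R ∙ x))
      v≈β·u = ≈S-trans v≈comb (comb-vanishingˡ R β _ (k*ᵥu≈0⇒k≈0 Rx≉0 (≈ᵥ-trans (≈ᵥ-sym vx·v≈α·u) (*ᵥ-zeroˡ v vx≈0))))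

    tangent-line : ∀ {w} → R ∙ w ≈ᵥ 0ᵥ → InConicPlane w R → TangentLine w R (outer (R ∙ x))
    tangent-line {w} Rw≈0 R∈w =
      independent , R∈w , outer∈conicPlane Rx∈w ,
      (R ∙ x , Rx≉0 , Rx∈w , (0# , 1# , comb-0-1 R (outer (R ∙ x))) , λ v v≉0 _ → unique v v≉0)
      where
      Rx∈w : OnLine w (R ∙ x)
      Rx∈w = trans (∙-symmetric R w x) (dot-zeroˡ x Rw≈0)

  exterior : ∀ {R x} → Rank2 R → quadratic R x ≈ 0# → NonzeroV (R ∙ x) → Exterior R
  exterior {R} {x} rank2 isotropic Rx≉0 =
    let (w , w≉0 , Rw≈0 , _) = rank2-kernel rank2 in
    (w , w≉0 , kernel⇒conicPlane w≉0 Rw≈0) ,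
    λ _ _ R∈plane → R , outer (R ∙ x) , tangent-line isotropic Rx≉0 (conicPlane⇒kernel R∈plane) R∈plane ,
                    (1# , 0# , comb-1-0 R (outer (R ∙ x)))

  nonzero-pairs : ∀ {σ₁ σ₂ l m} → σ₁ * m - σ₂ * l ≉ 0# → NonzeroPair σ₁ σ₂ × NonzeroPair l m
  nonzero-pairs D≉0 =
    (λ (σ₁≈0 , σ₂≈0) → D≉0 (trans (+-cong (x≈0⇒x*y≈0 σ₁≈0) (-‿cong (x≈0⇒x*y≈0 σ₂≈0))) (-‿inverseʳ 0#))) ,
    (λ (l≈0 , m≈0) → D≉0 (x*u-y*v≈0 m≈0 l≈0))

  second-point : ∀ {l m} → NonzeroPair l m → Σ K λ σ₁ → Σ K λ σ₂ → σ₁ * m - σ₂ * l ≉ 0#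
  second-point {l} {m} lm≉0 with l ≟ 0#
  ... | no  l≉0 = 0# , 1# , λ D≈0 → l≉0 (trans
        (solve 2 (λ l m → l := :- (ᴾ.0# :* m :- ᴾ.1# :* l)) refl l m) (trans (-‿cong D≈0) -0#≈0#))
  ... | yes l≈0 = 1# , 0# , λ D≈0 → lm≉0 (l≈0 , trans
        (solve 2 (λ l m → m := ᴾ.1# :* m :- ᴾ.0# :* l) refl l m) D≈0)

  pencil-nonzero : ∀ {σ₁ σ₂ l m} → σ₁ * m - σ₂ * l ≉ 0# → ∀ t → NonzeroPair (σ₁ + t * l) (σ₂ + t * m)
  pencil-nonzero {σ₁} {σ₂} {l} {m} D≉0 t = proj₁ (nonzero-pairs {l = l} {m} λ D′≈0 → D≉0 (trans
    (solve 5 (λ σ₁ σ₂ l m t → σ₁ :* m :- σ₂ :* l := (σ₁ :+ t :* l) :* m :- (σ₂ :+ t :* m) :* l) refl σ₁ σ₂ l m t)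
    D′≈0))

  cramerᵥ : ∀ {σ₁ σ₂ l m a b} → σ₁ * m - σ₂ * l ≉ 0# →
    σ₁ *ᵥ a +ᵥ σ₂ *ᵥ b ≈ᵥ 0ᵥ → l *ᵥ a +ᵥ m *ᵥ b ≈ᵥ 0ᵥ → a ≈ᵥ 0ᵥ × b ≈ᵥ 0ᵥ
  cramerᵥ {a = vec _ _ _} {vec _ _ _} D≉0 (p₁ , p₂ , p₃) (q₁ , q₂ , q₃) =
    let (a₁ , b₁) = cramer D≉0 p₁ q₁; (a₂ , b₂) = cramer D≉0 p₂ q₂; (a₃ , b₃) = cramer D≉0 p₃ q₃
    in (a₁ , a₂ , a₃) , (b₁ , b₂ , b₃)

  common-kernel : ∀ {σ₁ σ₂ l m A B x} → σ₁ * m - σ₂ * l ≉ 0# →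
    comb σ₁ A σ₂ B ∙ x ≈ᵥ 0ᵥ → comb l A m B ∙ x ≈ᵥ 0ᵥ → ∀ α β → comb α A β B ∙ x ≈ᵥ 0ᵥ
  common-kernel {σ₁} {σ₂} {l} {m} {A} {B} {x} D≉0 Sx≈0 Rx≈0 α β =
    let (Ax≈0 , Bx≈0) = cramerᵥ D≉0 (≈ᵥ-trans (≈ᵥ-sym (comb-∙ σ₁ A σ₂ B x)) Sx≈0)
                                     (≈ᵥ-trans (≈ᵥ-sym (comb-∙ l A m B x)) Rx≈0)
    in ≈ᵥ-trans (comb-∙ α A β B x) (+ᵥ-zero (*ᵥ-zeroʳ α Ax≈0) (*ᵥ-zeroʳ β Bx≈0))

  module _ {A B} (rank2 : ∀ λ' μ → NonzeroPair λ' μ → Rank2 (comb λ' A μ B))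
           {σ₁ σ₂ l m} (D≉0 : σ₁ * m - σ₂ * l ≉ 0#) where

    mixed-term-vanishes : ∀ {t₀} → t₀ ≉ 0# → t₀ ≉ 1# → ⟨ adj (comb σ₁ A σ₂ B) , comb l A m B ⟩ ≈ 0#
    mixed-term-vanishes t₀≉0 t₀≉1 = linear-two-roots (λ 1≈t₀ → t₀≉1 (sym 1≈t₀)) (root (proj₁ isField)) (root t₀≉0)
      where
      S = comb σ₁ A σ₂ B
      R = comb l A m B
      root : ∀ {t} → t ≉ 0# → ⟨ adj S , R ⟩ + t * ⟨ S , adj R ⟩ ≈ 0#
      root {t} t≉0 = x≉0∧x*y≈0⇒y≈0 t≉0 (begin
        t * (⟨ adj S , R ⟩ + t * ⟨ S , adj R ⟩)   ≈⟨ singular-pencil (proj₁ (rank2 σ₁ σ₂ σ≢0)) (proj₁ (rank2 l m lm≢0)) t ⟨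
        det (S +S (t ·S R))                       ≈⟨ det-cong (pencil-comb σ₁ σ₂ l m A B t) ⟩
        det (comb (σ₁ + t * l) A (σ₂ + t * m) B)  ≈⟨ proj₁ (rank2 _ _ (pencil-nonzero D≉0 t)) ⟩
        0#                                        ∎)
        where
        σ≢0 = proj₁ (nonzero-pairs D≉0)
        lm≢0 = proj₂ (nonzero-pairs D≉0)

    isotropic-vector : ∀ {t₀} → t₀ ≉ 0# → t₀ ≉ 1# →
      ¬ (Σ V3 λ w → NonzeroV w × (∀ λ' μ → NonzeroPair λ' μ → InConicPlane w (comb λ' A μ B))) →
      Σ V3 λ x → quadratic (comb l A m B) x ≈ 0# × NonzeroV (comb l A m B ∙ x)
    isotropic-vector t₀≉0 t₀≉1 no-common-plane =
      let (x , x≉0 , Sx≈0 , isotropic) = rank2-kernel (rank2 σ₁ σ₂ (proj₁ (nonzero-pairs D≉0))) in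
      x , isotropic _ (mixed-term-vanishes t₀≉0 t₀≉1) ,
      λ Rx≈0 → no-common-plane (x , x≉0 , λ α β _ → kernel⇒conicPlane x≉0 (common-kernel D≉0 Sx≈0 Rx≈0 α β))

module FiniteField {c ℓ} (F : CommutativeRing c ℓ) where
  open CommutativeRing F hiding (zero) renaming (Carrier to K)
  open Geometry F

  ≈-decidable : ∀ {q} → HasSize q → Decidable _≈_
  ≈-decidable (e , e-injective , e-surjective) x y =
    let (i , x≈eᵢ) = e-surjective x; (j , y≈eⱼ) = e-surjective y in
    map′ (λ i≡j → trans x≈eᵢ (trans (reflexive (≡.cong e i≡j)) (sym y≈eⱼ)))
         (λ x≈y → e-injective i j (trans (sym x≈eᵢ) (trans x≈y y≈eⱼ)))
         (i Fin.≟ j)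

  ≉-transfer : ∀ {x u c} → x ≈ c → x ≉ u → u ≉ c
  ≉-transfer x≈c x≉u u≈c = x≉u (trans x≈c (sym u≈c))

  avoid-one : Decidable _≈_ → ∀ {y z} → y ≉ z → ∀ c → y ≉ c ⊎ z ≉ c
  avoid-one _≟_ {y} y≉z c with y ≟ c
  ... | yes y≈c = inj₂ (≉-transfer y≈c y≉z)
  ... | no  y≉c = inj₁ y≉c

  avoid-two : Decidable _≈_ → ∀ {x y z} → x ≉ y → x ≉ z → y ≉ z → ∀ a b → Σ K λ t → t ≉ a × t ≉ b
  avoid-two _≟_ {x} {y} {z} x≉y x≉z y≉z a b with x ≟ a | x ≟ b
  ... | no x≉a  | no x≉b  = x , x≉a , x≉b
  ... | yes x≈a | _       = [ (λ y≉b → y , ≉-transfer x≈a x≉y , y≉b) , (λ z≉b → z , ≉-transfer x≈a x≉z , z≉b) ]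
                              (avoid-one _≟_ y≉z b)
  ... | no _    | yes x≈b = [ (λ y≉a → y , y≉a , ≉-transfer x≈b x≉y) , (λ z≉a → z , z≉a , ≉-transfer x≈b x≉z) ]
                              (avoid-one _≟_ y≉z a)

  at-least-three : ∀ {q} → OddPrimePower q → Σ ℕ λ r → q ≡ 3 ℕ.+ r
  at-least-three {0}                   (_ , 2∤0) = ⊥-elim (2∤0 (2 ∣0))
  at-least-three {1}                   ((p , k , p-prime , 1≡p^[k+1]) , _) =
    ⊥-elim (¬prime[1] (≡.subst Prime (ℕ.m*n≡1⇒m≡1 p (p ℕ.^ k) (≡.sym 1≡p^[k+1])) p-prime))
  at-least-three {2}                   (_ , 2∤2) = ⊥-elim (2∤2 ∣-refl)
  at-least-three {suc (suc (suc r))}   _         = r , ≡.refl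

  ∃≉0,1 : ∀ {q} → OddPrimePower q → HasSize q → Decidable _≈_ → Σ K λ t → t ≉ 0# × t ≉ 1#
  ∃≉0,1 q-odd (e , e-injective , _) _≟_ with at-least-three q-odd
  ... | r , ≡.refl = avoid-two _≟_ (distinct zero (suc zero) λ ()) (distinct zero (suc (suc zero)) λ ())
                                   (distinct (suc zero) (suc (suc zero)) λ ()) 0# 1#
    where
    distinct : ∀ i j → i ≢ j → e i ≉ e j
    distinct i j i≢j eᵢ≈eⱼ = i≢j (e-injective i j eᵢ≈eⱼ)

open Geometry

proposition4p3 : {c ℓ : Level} (F : CommutativeRing c ℓ) (q : ℕ) →
    OddPrimePower q → IsFiniteFieldOfOrder F q →
    (A B : Sym F) → Independent F A B →
    (∀ λ' μ → NonzeroPair F λ' μ → Rank2 F (comb F λ' A μ B)) →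
    ¬ (Σ (V3 F) λ w → NonzeroV F w ×
         (∀ λ' μ → NonzeroPair F λ' μ → InConicPlane F w (comb F λ' A μ B))) →
    ∀ λ' μ → NonzeroPair F λ' μ → Exterior F (comb F λ' A μ B)
proposition4p3 F _ q-odd (isField , size) _ _ _ rank2 no-common-plane l m lm≉0 =
  let (_ , t₀≉0 , t₀≉1)      = ∃≉0,1 q-odd size _≟_
      (_ , _ , D≉0)           = second-point lm≉0
      (_ , isotropic , Rx≉0)  = isotropic-vector rank2 D≉0 t₀≉0 t₀≉1 no-common-plane
  in exterior (rank2 l m lm≉0) isotropic Rx≉0
  where
  open FiniteField F
  _≟_ = ≈-decidable size
  open OverField F isField _≟_
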